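{- There exist pseudo-BCI algebras $\langle A,\leq,\twoheadrightarrow,\rightarrow,\top\rangle$ such that $\langle A,\twoheadrightarrow,\rightarrow,\top\rangle$ is not a Semi-BCI algebra.
   Context: A pseudo-BCI algebra is a structure $\langle A,\leq,\twoheadrightarrow,\rightarrow,\top\rangle$ with $\leq$ a binary relation on $A$, $\twoheadrightarrow,\rightarrow$ binary operations and $\top\in A$ such that for all $x,y,z$: (P1) $x\twoheadrightarrow y\leq(y\twoheadrightarrow z)\rightarrow(x\twoheadrightarrow z)$; (P2) $x\rightarrow y\leq(y\rightarrow z)\twoheadrightarrow(x\rightarrow z)$; (P3) $x\leq(x\twoheadrightarrow y)\rightarrow y$; (P4) $x\leq(x\rightarrow y)\twoheadrightarrow y$; (P5) $x\leq x$; (P6) $x\leq y$ and $y\leq x$ imply $x=y$; (P7) $x\leq y$ iff $x\twoheadrightarrow y=\top$ iff $x\rightarrow y=\top$. A Semi-BCI (SBCI) algebra is a structure $\langle A,\twoheadrightarrow,\rightarrow,\top\rangle$, where $x\ll y$ iff $x\twoheadrightarrow y=\top$ and $x\preceq y$ iff $x\rightarrow y=\top$, such that for all $x,y,z$: (S1) $x\twoheadrightarrow(y\twoheadrightarrow z)=y\twoheadrightarrow(x\twoheadrightarrow z)$; (S2) $x\rightarrow(y\rightarrow z)=y\rightarrow(x\rightarrow z)$; (S3) $x\twoheadrightarrow y\preceq(z\twoheadrightarrow x)\rightarrow(z\twoheadrightarrow y)$; (S4) $\top\twoheadrightarrow x=x$; (S5) if $x\ll y\preceq z$ then $x\ll z$;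 (S6) if $x\preceq y\ll z$ then $x\ll z$; (S7) if $x\preceq y$ and $y\preceq x$ then $x=y$. -}

module Defs where

open import Data.Product using (_×_)
open import Relation.Binary.PropositionalEquality using (_≡_)

record IsPseudoBCI (A : Set) (_≤_ : A → A → Set)
                   (_↠_ _⇒_ : A → A → A) (⊤ : A) : Set where
  field
    P1  : ∀ x y z → (x ↠ y) ≤ ((y ↠ z) ⇒ (x ↠ z))
    P2  : ∀ x y z → (x ⇒ y) ≤ ((y ⇒ z) ↠ (x ⇒ z))
    P3  : ∀ x y → x ≤ ((x ↠ y) ⇒ y)
    P4  : ∀ x y → x ≤ ((x ⇒ y) ↠ y)
    P5  : ∀ x → x ≤ x
    P6  : ∀ x y → x ≤ y → y ≤ x → x ≡ y
    -- P7: x ≤ y  iff  x ↠ y = ⊤  iff  x → y = ⊤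
    P7a : ∀ x y → x ≤ y → (x ↠ y) ≡ ⊤
    P7b : ∀ x y → (x ↠ y) ≡ ⊤ → x ≤ y
    P7c : ∀ x y → x ≤ y → (x ⇒ y) ≡ ⊤
    P7d : ∀ x y → (x ⇒ y) ≡ ⊤ → x ≤ y

module _ {A : Set} (_↠_ _⇒_ : A → A → A) (⊤ : A) where
  _≪_ : A → A → Set
  x ≪ y = (x ↠ y) ≡ ⊤

  _⪯_ : A → A → Set
  x ⪯ y = (x ⇒ y) ≡ ⊤

record IsSBCI (A : Set) (_↠_ _⇒_ : A → A → A) (⊤ : A) : Set where
  private
    _≪'_ = _≪_ _↠_ _⇒_ ⊤
    _⪯'_ = _⪯_ _↠_ _⇒_ ⊤
  field
    S1 : ∀ x y z → (x ↠ (y ↠ z)) ≡ (y ↠ (x ↠ z))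
    S2 : ∀ x y z → (x ⇒ (y ⇒ z)) ≡ (y ⇒ (x ⇒ z))
    S3 : ∀ x y z → (x ↠ y) ⪯' ((z ↠ x) ⇒ (z ↠ y))
    S4 : ∀ x → (⊤ ↠ x) ≡ x
    S5 : ∀ x y z → x ≪' y → y ⪯' z → x ≪' z
    S6 : ∀ x y z → x ⪯' y → y ≪' z → x ≪' z
    S7 : ∀ x y → x ⪯' y → y ⪯' x → x ≡ y

module Submission where

-- The counterexample lives on the four-element chain 0 < 1 < 2 < 3 with
-- top element 3 and two implications ↠ and ⇒ given by explicit tables.
-- The proof has two parts.
--
--  * A general construction: whenever ↠ and ⇒ send the same pairs to ⊤,
--    the relation x ≪ y (i.e. x ↠ y = ⊤) makes axioms P7a–P7d hold, so
--    ⟨A, ≪, ↠, ⇒, ⊤⟩ is a pseudo-BCI algebra as soon as P1–P6 hold for ≪.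
--  * On the finite carrier Fin 4 every remaining axiom is a decidable
--    statement quantifying over finitely many elements, so it is
--    established by evaluating its decision procedure (Fin's all?).
--
-- Finally the exchange law S1 fails at (x, y, z) = (1, 2, 0):
-- 1 ↠ (2 ↠ 0) = 3 whereas 2 ↠ (1 ↠ 0) = 1, so the structure is not SBCI.

open import Defs
open import Data.Fin using (Fin; _≟_)
open import Data.Fin.Patterns using (0F; 1F; 2F; 3F)
open import Data.Fin.Properties using (all?)
open import Data.Product using (Σ; _×_; _,_)
open import Function using (id)
open import Relation.Nullary using (¬_; Dec)
open import Relation.Nullary.Decidable using (_→-dec_; toWitness)
open import Relation.Binary.PropositionalEquality using (_≡_; _≢_; refl)

module OrderFromArrow {A : Set} (_↠_ _⇒_ : A → A → A) (⊤ : A) where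

  _≤_ : A → A → Set
  _≤_ = _≪_ _↠_ _⇒_ ⊤

  isPseudoBCI :
    (∀ x y z → (x ↠ y) ≤ ((y ↠ z) ⇒ (x ↠ z))) →
    (∀ x y z → (x ⇒ y) ≤ ((y ⇒ z) ↠ (x ⇒ z))) →
    (∀ x y → x ≤ ((x ↠ y) ⇒ y)) →
    (∀ x y → x ≤ ((x ⇒ y) ↠ y)) →
    (∀ x → x ≤ x) →
    (∀ x y → x ≤ y → y ≤ x → x ≡ y) →
    (∀ x y → x ↠ y ≡ ⊤ → x ⇒ y ≡ ⊤) →
    (∀ x y → x ⇒ y ≡ ⊤ → x ↠ y ≡ ⊤) →
    IsPseudoBCI A _≤_ _↠_ _⇒_ ⊤
  isPseudoBCI p1 p2 p3 p4 p5 p6 ↠⊤⇒⇒⊤ ⇒⊤⇒↠⊤ = record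
    { P1 = p1 ; P2 = p2 ; P3 = p3 ; P4 = p4 ; P5 = p5 ; P6 = p6
    ; P7a = λ _ _ → id ; P7b = λ _ _ → id
    ; P7c = ↠⊤⇒⇒⊤ ; P7d = ⇒⊤⇒↠⊤ }

exchange-failure⇒¬SBCI : {A : Set} {_↠_ _⇒_ : A → A → A} {⊤ : A} (x y z : A) →
  (x ↠ (y ↠ z)) ≢ (y ↠ (x ↠ z)) → ¬ IsSBCI A _↠_ _⇒_ ⊤
exchange-failure⇒¬SBCI x y z fails sbci = fails (IsSBCI.S1 sbci x y z)

-- The counterexample: the chain 0 < 1 < 2 < 3 with top 3.  Both
-- implications return 3 exactly on pairs x ≤ y of the chain, and 3 ↠ y =
-- 3 ⇒ y = y; they differ on the remaining pairs (1,0), (2,0), (2,1).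
⊤ : Fin 4
⊤ = 3F

_↠_ : Fin 4 → Fin 4 → Fin 4
1F ↠ 0F = 1F
2F ↠ 0F = 1F
2F ↠ 1F = 1F
3F ↠ y  = y
_  ↠ _  = 3F

_⇒_ : Fin 4 → Fin 4 → Fin 4
1F ⇒ 0F = 2F
2F ⇒ 0F = 0F
2F ⇒ 1F = 1F
3F ⇒ y  = y
_  ⇒ _  = 3F

open OrderFromArrow _↠_ _⇒_ ⊤

_≤?_ : (x y : Fin 4) → Dec (x ≤ y)
x ≤? y = (x ↠ y) ≟ ⊤

P1-holds : ∀ x y z → (x ↠ y) ≤ ((y ↠ z) ⇒ (x ↠ z))
P1-holds = toWitness {a? = all? λ x → all? λ y → all? λ z →
  (x ↠ y) ≤? ((y ↠ z) ⇒ (x ↠ z))} _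

P2-holds : ∀ x y z → (x ⇒ y) ≤ ((y ⇒ z) ↠ (x ⇒ z))
P2-holds = toWitness {a? = all? λ x → all? λ y → all? λ z →
  (x ⇒ y) ≤? ((y ⇒ z) ↠ (x ⇒ z))} _

P3-holds : ∀ x y → x ≤ ((x ↠ y) ⇒ y)
P3-holds = toWitness {a? = all? λ x → all? λ y → x ≤? ((x ↠ y) ⇒ y)} _

P4-holds : ∀ x y → x ≤ ((x ⇒ y) ↠ y)
P4-holds = toWitness {a? = all? λ x → all? λ y → x ≤? ((x ⇒ y) ↠ y)} _

P5-holds : ∀ x → x ≤ x
P5-holds = toWitness {a? = all? λ x → x ≤? x} _

P6-holds : ∀ x y → x ≤ y → y ≤ x → x ≡ y
P6-holds = toWitness {a? = all? λ x → all? λ y →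
  (x ≤? y) →-dec (y ≤? x) →-dec (x ≟ y)} _

↠⊤⇒⇒⊤ : ∀ x y → x ↠ y ≡ ⊤ → x ⇒ y ≡ ⊤
↠⊤⇒⇒⊤ = toWitness {a? = all? λ x → all? λ y →
  ((x ↠ y) ≟ ⊤) →-dec ((x ⇒ y) ≟ ⊤)} _

⇒⊤⇒↠⊤ : ∀ x y → x ⇒ y ≡ ⊤ → x ↠ y ≡ ⊤
⇒⊤⇒↠⊤ = toWitness {a? = all? λ x → all? λ y →
  ((x ⇒ y) ≟ ⊤) →-dec ((x ↠ y) ≟ ⊤)} _

exchange-fails : (1F ↠ (2F ↠ 0F)) ≢ (2F ↠ (1F ↠ 0F))
exchange-fails ()

proposition16 : Σ Set λ A → Σ (A → A → Set) λ _≤_ → Σ (A → A → A) λ _↠_ → Σ (A → A → A) λ _⇒_ → Σ A λ ⊤ →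
    IsPseudoBCI A _≤_ _↠_ _⇒_ ⊤ × ¬ IsSBCI A _↠_ _⇒_ ⊤
proposition16 =
  Fin 4 , _≤_ , _↠_ , _⇒_ , ⊤ ,
  isPseudoBCI P1-holds P2-holds P3-holds P4-holds P5-holds P6-holds ↠⊤⇒⇒⊤ ⇒⊤⇒↠⊤ ,
  exchange-failure⇒¬SBCI 1F 2F 0F exchange-fails
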